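{- For every odd integer $t\geq 1$ and every integer $n\geq 0$, $$\overline{p}_{ -t}(n)\equiv\begin{cases}1\pmod 4 & \text{if } n=0,\\ 2\pmod 4 & \text{if } n \text{ is a positive perfect square},\\ 0 \pmod 4 & \text{otherwise}.\end{cases}$$
   Context: For a positive integer $r$, let $f_r=\prod_{m\geq 1}(1-q^{rm})$. For a positive integer $t$, $\overline{p}_{ -t}(n)$ (the number of $t$-colored overpartitions of $n$) is defined by $\sum_{n\geq 0}\overline{p}_{ -t}(n)q^n=\left(f_2/f_1^{2}\right)^t$. -}

module Defs where

open import Data.Nat as ℕ using (ℕ; zero; suc; _∸_)
open import Data.Integer as ℤ using (ℤ; +_; _+_; _*_; -_)
open import Data.List using (List; []; _∷_; upTo; map; foldr; zipWith)
open import Relation.Nullary using (yes; no)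

sumℤ : List ℤ → ℤ
sumℤ = foldr _+_ (+ 0)

Series : Set
Series = ℕ → ℤ

one : Series
one zero    = + 1
one (suc _) = + 0

_⊛_ : Series → Series → Series
(a ⊛ b) n = sumℤ (map (λ k → a k * b (n ∸ k)) (upTo (suc n)))

infixl 7 _⊛_

_^ˢ_ : Series → ℕ → Series
a ^ˢ zero  = one
a ^ˢ suc t = a ⊛ (a ^ˢ t)

oneMinusQ^ : ℕ → Series
oneMinusQ^ e n = if0 + (- ifE)
  where
  if0 : ℤ
  if0 with n ℕ.≟ 0
  ... | yes _ = + 1
  ... | no  _ = + 0
  ifE : ℤ
  ifE with n ℕ.≟ e
  ... | yes _ = + 1
  ... | no  _ = + 0

finProd : ℕ → ℕ → Series
finProd r zero    = one
finProd r (suc N) = oneMinusQ^ (r ℕ.* suc N) ⊛ finProd r N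

-- f_r = ∏_{m ≥ 1} (1 - q^{r m}).  For r ≥ 1, factors with m > n do not affect
-- the coefficient of q^n, so the n-th coefficient of the infinite product is
-- that of the finite product up to m = n.
f : ℕ → Series
f r n = finProd r n n

-- Multiplicative inverse of a series with constant term 1:
-- b_0 = 1,  b_n = - Σ_{k=1}^{n} a_k b_{n-k}.
-- invList a n = [b_n, b_{n-1}, ..., b_0]
invList : Series → ℕ → List ℤ
invList a zero    = + 1 ∷ []
invList a (suc n) = (- sumℤ (zipWith _*_ (map a (map suc (upTo (suc n)))) prev)) ∷ prev
  where
  prev : List ℤ
  prev = invList a n   -- [b_n, ..., b_0], paired with a_1, ..., a_{n+1}

head0 : List ℤ → ℤ
head0 []      = + 0
head0 (x ∷ _) = x

inv : Series → Series
inv a n = head0 (invList a n)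

-- Σ_n p̄_{-t}(n) q^n = (f_2 / f_1^2)^t
pbar : ℕ → ℕ → ℤ
pbar t n = ((f 2 ⊛ inv (f 1 ⊛ f 1)) ^ˢ t) n

open import Relation.Binary.PropositionalEquality using (_≡_; refl)
private
  _ : map (pbar 1) (upTo 6) ≡ (+ 1 ∷ + 2 ∷ + 4 ∷ + 8 ∷ + 14 ∷ + 24 ∷ [])
  _ = refl

-- Modulo 4, (1 - q^e)² ≡ (1 - q^{2e}) (1 + 2 Σ_{j≥1} q^{ej}), and products of series of the form
-- 1 + 2x multiply like 1 + 2 Σ x.  Hence f₁² ≡ f₂ (1 + 2 Σ_{n≥1} d(n) q^n), where d(n) counts the
-- divisors of n; as d(n) is odd exactly for squares, f₁² ≡ f₂ φ with φ = 1 + 2 Σ_{m≥1} q^{m²}.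
-- Since φ² ≡ 1, the quotient f₂ / f₁² and all its odd powers are ≡ φ, whose coefficients are
-- 1 at n = 0, 2 at positive squares and 0 elsewhere.
module Submission where

open import Defs
open import Data.Nat using (ℕ; suc; _*_; _+_; _≥_)
open import Data.Integer.DivMod using (_%ℕ_)
open import Data.Product using (_×_; ∃-syntax)
open import Relation.Nullary using (¬_)
open import Relation.Binary.PropositionalEquality using (_≡_)

open import Data.Nat as ℕ using (zero; _∸_; _≤_; _<_; z≤n; s≤s; NonZero)
import Data.Nat.Properties as ℕP
import Data.Nat.Divisibility as ℕ∣
open import Data.Integer using (ℤ; +_; -[1+_]; -_; _-_) renaming (_+_ to _⊕_; _*_ to _⊗_)
import Data.Integer.Properties as ℤP
open import Algebra.Properties.CommutativeSemigroup ℤP.+-commutativeSemigroup using () renaming (x∙yz≈y∙xz to +-left-comm)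
import Algebra.Properties.CommutativeSemigroup ℕP.+-commutativeSemigroup as ℕ+
open import Data.Integer.Tactic.RingSolver using (solve-∀)
open import Data.Nat.Tactic.RingSolver using () renaming (solve-∀ to ℕ-solve-∀)
open import Data.Integer.DivMod using (_/ℕ_; a≡a%ℕn+[a/ℕn]*n; n%ℕd<d)
open import Data.List using (_∷_; upTo; map; zipWith; applyUpTo)
open import Data.Product using (_,_)
open import Data.Sum using (inj₁; inj₂)
open import Data.Empty using (⊥-elim)
open import Function using (_∘_; _$_)
open import Relation.Nullary using (Dec; yes; no)
open import Relation.Binary.Bundles using (Setoid)
open import Algebra.Bundles using (CommutativeSemigroup)
open import Data.Integer.Divisibility.Signed using (_∣_; divides; ∣m∣n⇒∣m+n; ∣m⇒∣-m; ∣n⇒∣m*n; ∣m⇒∣m*n; module ∣-Reasoning)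
open import Relation.Binary.Definitions using (tri<; tri≈; tri>)
open import Relation.Binary.PropositionalEquality using (_≗_; refl; sym; trans; cong; cong₂; subst; module ≡-Reasoning)
import Relation.Binary.Reasoning.Setoid as SetoidReasoning

-- Congruences

infix 4 _≡_mod_
record _≡_mod_ (x y m : ℤ) : Set where
  constructor ≡mod
  field
    m∣x-y : m ∣ x - y

module _ {m : ℤ} where

  ≡+q*m⇒≡mod : ∀ {x y} q → x ≡ y ⊕ q ⊗ m → x ≡ y mod m
  ≡+q*m⇒≡mod {y = y} q refl = ≡mod (divides q (y+qm-y≡qm y q m))
    where
    y+qm-y≡qm : ∀ y q m → (y ⊕ q ⊗ m) - y ≡ q ⊗ m
    y+qm-y≡qm = solve-∀

  ≡⇒≡mod : ∀ {x y} → x ≡ y → x ≡ y mod m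
  ≡⇒≡mod {y = y} refl = ≡+q*m⇒≡mod (+ 0) (sym (trans (cong (y ⊕_) (ℤP.*-zeroˡ m)) (ℤP.+-identityʳ y)))

  ≡mod-refl : ∀ {x} → x ≡ x mod m
  ≡mod-refl {x} = ≡⇒≡mod {x} refl

  ≡mod-sym : ∀ {x y} → x ≡ y mod m → y ≡ x mod m
  ≡mod-sym {x} {y} (≡mod p) = ≡mod $ begin
      m           ∣⟨ ∣m⇒∣-m p ⟩
      - (x - y)   ≡⟨ -[x-y]≡y-x x y ⟩
      y - x       ∎
    where
    open ∣-Reasoning
    -[x-y]≡y-x : ∀ x y → - (x - y) ≡ y - x
    -[x-y]≡y-x = solve-∀

  ≡mod-trans : ∀ {x y z} → x ≡ y mod m → y ≡ z mod m → x ≡ z mod m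
  ≡mod-trans {x} {y} {z} (≡mod p) (≡mod q) = ≡mod $ begin
      m                   ∣⟨ ∣m∣n⇒∣m+n p q ⟩
      (x - y) ⊕ (y - z)   ≡⟨ telescope x y z ⟩
      x - z               ∎
    where
    open ∣-Reasoning
    telescope : ∀ x y z → (x - y) ⊕ (y - z) ≡ x - z
    telescope = solve-∀

  +-cong-mod : ∀ {x x′ y y′} → x ≡ x′ mod m → y ≡ y′ mod m → x ⊕ y ≡ x′ ⊕ y′ mod m
  +-cong-mod {x} {x′} {y} {y′} (≡mod p) (≡mod q) = ≡mod $ begin
      m                     ∣⟨ ∣m∣n⇒∣m+n p q ⟩
      (x - x′) ⊕ (y - y′)   ≡⟨ regroup x x′ y y′ ⟩
      (x ⊕ y) - (x′ ⊕ y′)   ∎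
    where
    open ∣-Reasoning
    regroup : ∀ x x′ y y′ → (x - x′) ⊕ (y - y′) ≡ (x ⊕ y) - (x′ ⊕ y′)
    regroup = solve-∀

  *-cong-mod : ∀ {x x′ y y′} → x ≡ x′ mod m → y ≡ y′ mod m → x ⊗ y ≡ x′ ⊗ y′ mod m
  *-cong-mod {x} {x′} {y} {y′} (≡mod p) (≡mod q) = ≡mod $ begin
      m                              ∣⟨ ∣m∣n⇒∣m+n (∣m⇒∣m*n y p) (∣n⇒∣m*n x′ q) ⟩
      (x - x′) ⊗ y ⊕ x′ ⊗ (y - y′)   ≡⟨ regroup x x′ y y′ ⟩
      x ⊗ y - x′ ⊗ y′                ∎
    where
    open ∣-Reasoning
    regroup : ∀ x x′ y y′ → (x - x′) ⊗ y ⊕ x′ ⊗ (y - y′) ≡ x ⊗ y - x′ ⊗ y′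
    regroup = solve-∀

  ≡mod-setoid : Setoid _ _
  ≡mod-setoid = record
    { Carrier = ℤ
    ; _≈_ = _≡_mod m
    ; isEquivalence = record { refl = ≡mod-refl ; sym = ≡mod-sym ; trans = ≡mod-trans }
    }

≡mod-%ℕ : ∀ x d .{{_ : NonZero d}} → x ≡ + (x %ℕ d) mod + d
≡mod-%ℕ x d = ≡+q*m⇒≡mod (x /ℕ d) (a≡a%ℕn+[a/ℕn]*n x d)

module _ {d : ℕ} where

  private
    multiple-difference⇒≥ : ∀ {a} b j → + a - + b ≡ + suc j ⊗ + d → d ≤ a
    multiple-difference⇒≥ {a} b j eq = begin
        d              ≤⟨ ℕP.m≤n*m d (suc j) ⟩
        suc j * d      ≤⟨ ℕP.m≤n+m (suc j * d) b ⟩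
        b + suc j * d  ≡⟨ ℤP.+-injective (trans (cong (+ b ⊕_) (trans (ℤP.pos-* (suc j) d) (sym eq))) (b+[a-b]≡a (+ a) (+ b))) ⟩
        a              ∎
      where
      open ℕP.≤-Reasoning
      b+[a-b]≡a : ∀ a b → b ⊕ (a - b) ≡ a
      b+[a-b]≡a = solve-∀

  <-≡mod⇒≡ : ∀ {r r′} → r < d → r′ < d → + r ≡ + r′ mod + d → r ≡ r′
  <-≡mod⇒≡ {r} {r′} _ _ (≡mod (divides (+ zero) eq)) =
    ℤP.+-injective (ℤP.i-j≡0⇒i≡j (+ r) (+ r′) (trans eq (ℤP.*-zeroˡ (+ d))))
  <-≡mod⇒≡ {r′ = r′} r<d _ (≡mod (divides (+ suc j) eq)) = ⊥-elim (ℕP.<⇒≱ r<d (multiple-difference⇒≥ r′ j eq))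
  <-≡mod⇒≡ {r} {r′} _ r′<d (≡mod (divides -[1+ j ] eq)) = ⊥-elim (ℕP.<⇒≱ r′<d (multiple-difference⇒≥ r j (begin
      + r′ - + r                   ≡⟨ -[x-y]≡y-x (+ r) (+ r′) ⟨
      - (+ r - + r′)               ≡⟨ cong -_ eq ⟩
      - (-[1+ j ] ⊗ + d)           ≡⟨ ℤP.neg-distribˡ-* -[1+ j ] (+ d) ⟩
      + suc j ⊗ + d                ∎)))
    where
    open ≡-Reasoning
    -[x-y]≡y-x : ∀ x y → - (x - y) ≡ y - x
    -[x-y]≡y-x = solve-∀

≡mod⇒%ℕ≡ : ∀ {x r} d .{{_ : NonZero d}} → x ≡ + r mod + d → r < d → x %ℕ d ≡ r
≡mod⇒%ℕ≡ {x} d x≡r r<d = <-≡mod⇒≡ (n%ℕd<d x d) r<d (≡mod-trans (≡mod-sym (≡mod-%ℕ x d)) x≡r)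

-- Formal power series

infix 4 _≡ˢ_mod_
_≡ˢ_mod_ : Series → Series → ℤ → Set
a ≡ˢ b mod m = ∀ n → a n ≡ b n mod m

module _ {m : ℤ} where

  ≗⇒≡ˢmod : ∀ {a b} → a ≗ b → a ≡ˢ b mod m
  ≗⇒≡ˢmod a≗b n = ≡⇒≡mod (a≗b n)

  ≡ˢmod-setoid : Setoid _ _
  ≡ˢmod-setoid = record
    { Carrier = Series
    ; _≈_ = _≡ˢ_mod m
    ; isEquivalence = record
      { refl = λ _ → ≡mod-refl
      ; sym = λ p n → ≡mod-sym (p n)
      ; trans = λ p q n → ≡mod-trans (p n) (q n)
      }
    }

infixl 6 _+ˢ_
_+ˢ_ : Series → Series → Series
(a +ˢ b) n = a n ⊕ b n

infixl 7 _·ˢ_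
_·ˢ_ : ℤ → Series → Series
(x ·ˢ a) n = x ⊗ a n

-ˢ_ : Series → Series
(-ˢ a) n = - a n

tail : Series → Series
tail a n = a (suc n)

-- A recursive form of the Cauchy product _⊛_ (see ⊛≗∗), suited to induction.
infixl 7 _∗_
_∗_ : Series → Series → Series
(a ∗ b) zero    = a 0 ⊗ b 0
(a ∗ b) (suc n) = a 0 ⊗ b (suc n) ⊕ (tail a ∗ b) n

map-applyUpTo : ∀ {A B : Set} (g : A → B) (h : ℕ → A) n → map g (applyUpTo h n) ≡ applyUpTo (g ∘ h) n
map-applyUpTo g h zero    = refl
map-applyUpTo g h (suc n) = cong (g (h 0) ∷_) (map-applyUpTo g (h ∘ suc) n)

⊛≗∗ : ∀ a b → a ⊛ b ≗ a ∗ b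
⊛≗∗ a b n = trans (cong sumℤ (map-applyUpTo (λ k → a k ⊗ b (n ∸ k)) (λ k → k) (suc n))) (sum≡∗ n a)
  where
  sum≡∗ : ∀ n a → sumℤ (applyUpTo (λ k → a k ⊗ b (n ∸ k)) (suc n)) ≡ (a ∗ b) n
  sum≡∗ zero    a = ℤP.+-identityʳ _
  sum≡∗ (suc n) a = cong (a 0 ⊗ b (suc n) ⊕_) (sum≡∗ n (tail a))

∗-cong : ∀ {a a′ b b′} → a ≗ a′ → b ≗ b′ → a ∗ b ≗ a′ ∗ b′
∗-cong a≗a′ b≗b′ zero    = cong₂ _⊗_ (a≗a′ 0) (b≗b′ 0)
∗-cong a≗a′ b≗b′ (suc n) = cong₂ _⊕_ (cong₂ _⊗_ (a≗a′ 0) (b≗b′ (suc n))) (∗-cong (a≗a′ ∘ suc) b≗b′ n)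

∗-cong-≤-mod : ∀ {m a a′ b b′} n → (∀ k → k ≤ n → a k ≡ a′ k mod m) → (∀ k → k ≤ n → b k ≡ b′ k mod m) →
               (a ∗ b) n ≡ (a′ ∗ b′) n mod m
∗-cong-≤-mod zero    a≡a′ b≡b′ = *-cong-mod (a≡a′ 0 z≤n) (b≡b′ 0 z≤n)
∗-cong-≤-mod (suc n) a≡a′ b≡b′ = +-cong-mod (*-cong-mod (a≡a′ 0 z≤n) (b≡b′ (suc n) ℕP.≤-refl))
  (∗-cong-≤-mod n (λ k k≤n → a≡a′ (suc k) (s≤s k≤n)) (λ k k≤n → b≡b′ k (ℕP.m≤n⇒m≤1+n k≤n)))

∗-cong-mod : ∀ {m a a′ b b′} → a ≡ˢ a′ mod m → b ≡ˢ b′ mod m → a ∗ b ≡ˢ a′ ∗ b′ mod m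
∗-cong-mod a≡a′ b≡b′ n = ∗-cong-≤-mod n (λ k _ → a≡a′ k) (λ k _ → b≡b′ k)

∗-zeroˡ : ∀ b → (λ _ → + 0) ∗ b ≗ λ _ → + 0
∗-zeroˡ b zero    = ℤP.*-zeroˡ (b 0)
∗-zeroˡ b (suc n) = cong₂ _⊕_ (ℤP.*-zeroˡ (b (suc n))) (∗-zeroˡ b n)

∗-identityˡ : ∀ b → one ∗ b ≗ b
∗-identityˡ b zero    = ℤP.*-identityˡ (b 0)
∗-identityˡ b (suc n) = trans (cong₂ _⊕_ (ℤP.*-identityˡ (b (suc n))) (∗-zeroˡ b n)) (ℤP.+-identityʳ _)

∗-comm : ∀ a b → a ∗ b ≗ b ∗ a
∗-comm a b zero          = ℤP.*-comm (a 0) (b 0)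
∗-comm a b (suc zero)    = swap-products (a 0) (a 1) (b 0) (b 1)
  where
  swap-products : ∀ a₀ a₁ b₀ b₁ → a₀ ⊗ b₁ ⊕ a₁ ⊗ b₀ ≡ b₀ ⊗ a₁ ⊕ b₁ ⊗ a₀
  swap-products = solve-∀
∗-comm a b (suc (suc n)) = begin
    a 0 ⊗ b (2 + n) ⊕ (tail a ∗ b) (suc n)
  ≡⟨ cong (a 0 ⊗ b (2 + n) ⊕_) (∗-comm (tail a) b (suc n)) ⟩
    a 0 ⊗ b (2 + n) ⊕ (b 0 ⊗ a (2 + n) ⊕ (tail b ∗ tail a) n)
  ≡⟨ cong (λ z → a 0 ⊗ b (2 + n) ⊕ (b 0 ⊗ a (2 + n) ⊕ z)) (∗-comm (tail b) (tail a) n) ⟩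
    a 0 ⊗ b (2 + n) ⊕ (b 0 ⊗ a (2 + n) ⊕ (tail a ∗ tail b) n)
  ≡⟨ +-left-comm (a 0 ⊗ b (2 + n)) (b 0 ⊗ a (2 + n)) _ ⟩
    b 0 ⊗ a (2 + n) ⊕ (a 0 ⊗ b (2 + n) ⊕ (tail a ∗ tail b) n)
  ≡⟨ cong (b 0 ⊗ a (2 + n) ⊕_) (∗-comm a (tail b) (suc n)) ⟩
    b 0 ⊗ a (2 + n) ⊕ (tail b ∗ a) (suc n)
  ∎
  where open ≡-Reasoning

∗-distribʳ-+ : ∀ c a b → (a +ˢ b) ∗ c ≗ a ∗ c +ˢ b ∗ c
∗-distribʳ-+ c a b zero    = ℤP.*-distribʳ-+ (c 0) (a 0) (b 0)
∗-distribʳ-+ c a b (suc n) = trans (cong ((a 0 ⊕ b 0) ⊗ c (suc n) ⊕_) (∗-distribʳ-+ c (tail a) (tail b) n))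
  (expand (a 0) (b 0) (c (suc n)) ((tail a ∗ c) n) ((tail b ∗ c) n))
  where
  expand : ∀ a₀ b₀ c x y → (a₀ ⊕ b₀) ⊗ c ⊕ (x ⊕ y) ≡ (a₀ ⊗ c ⊕ x) ⊕ (b₀ ⊗ c ⊕ y)
  expand = solve-∀

∗-scaleˡ : ∀ x a c → (x ·ˢ a) ∗ c ≗ x ·ˢ (a ∗ c)
∗-scaleˡ x a c zero    = ℤP.*-assoc x (a 0) (c 0)
∗-scaleˡ x a c (suc n) = trans (cong (x ⊗ a 0 ⊗ c (suc n) ⊕_) (∗-scaleˡ x (tail a) c n))
  (factor-out x (a 0) (c (suc n)) ((tail a ∗ c) n))
  where
  factor-out : ∀ x a₀ c y → x ⊗ a₀ ⊗ c ⊕ x ⊗ y ≡ x ⊗ (a₀ ⊗ c ⊕ y)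
  factor-out = solve-∀

∗-negˡ : ∀ a c → (-ˢ a) ∗ c ≗ -ˢ (a ∗ c)
∗-negˡ a c zero    = sym (ℤP.neg-distribˡ-* (a 0) (c 0))
∗-negˡ a c (suc n) = trans (cong (- a 0 ⊗ c (suc n) ⊕_) (∗-negˡ (tail a) c n))
  (factor-out (a 0) (c (suc n)) ((tail a ∗ c) n))
  where
  factor-out : ∀ x y z → - x ⊗ y ⊕ - z ≡ - (x ⊗ y ⊕ z)
  factor-out = solve-∀

∗-assoc : ∀ a b c → (a ∗ b) ∗ c ≗ a ∗ (b ∗ c)
∗-assoc a b c zero    = ℤP.*-assoc (a 0) (b 0) (c 0)
∗-assoc a b c (suc n) = sym $ begin
    a 0 ⊗ (b 0 ⊗ c (suc n) ⊕ (tail b ∗ c) n) ⊕ (tail a ∗ (b ∗ c)) n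
  ≡⟨ cong (a 0 ⊗ (b 0 ⊗ c (suc n) ⊕ (tail b ∗ c) n) ⊕_) (∗-assoc (tail a) b c n) ⟨
    a 0 ⊗ (b 0 ⊗ c (suc n) ⊕ (tail b ∗ c) n) ⊕ (tail a ∗ b ∗ c) n
  ≡⟨ distribute (a 0) (b 0) (c (suc n)) ((tail b ∗ c) n) ((tail a ∗ b ∗ c) n) ⟩
    a 0 ⊗ b 0 ⊗ c (suc n) ⊕ (a 0 ⊗ (tail b ∗ c) n ⊕ (tail a ∗ b ∗ c) n)
  ≡⟨ cong (λ z → a 0 ⊗ b 0 ⊗ c (suc n) ⊕ (z ⊕ (tail a ∗ b ∗ c) n)) (∗-scaleˡ (a 0) (tail b) c n) ⟨
    a 0 ⊗ b 0 ⊗ c (suc n) ⊕ (((a 0 ·ˢ tail b) ∗ c) n ⊕ (tail a ∗ b ∗ c) n)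
  ≡⟨ cong (a 0 ⊗ b 0 ⊗ c (suc n) ⊕_) (∗-distribʳ-+ c (a 0 ·ˢ tail b) (tail a ∗ b) n) ⟨
    (a ∗ b ∗ c) (suc n)
  ∎
  where
  open ≡-Reasoning
  distribute : ∀ a₀ b₀ c x y → a₀ ⊗ (b₀ ⊗ c ⊕ x) ⊕ y ≡ a₀ ⊗ b₀ ⊗ c ⊕ (a₀ ⊗ x ⊕ y)
  distribute = solve-∀

∗-identityʳ : ∀ b → b ∗ one ≗ b
∗-identityʳ b n = trans (∗-comm b one n) (∗-identityˡ b n)

∗-distribˡ-+ : ∀ c a b → c ∗ (a +ˢ b) ≗ c ∗ a +ˢ c ∗ b
∗-distribˡ-+ c a b n = trans (∗-comm c (a +ˢ b) n)
  (trans (∗-distribʳ-+ c a b n) (cong₂ _⊕_ (∗-comm a c n) (∗-comm b c n)))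

∗-scaleʳ : ∀ x a c → c ∗ (x ·ˢ a) ≗ x ·ˢ (c ∗ a)
∗-scaleʳ x a c n = trans (∗-comm c (x ·ˢ a) n)
  (trans (∗-scaleˡ x a c n) (cong (x ⊗_) (∗-comm a c n)))

∗-commutativeSemigroup : CommutativeSemigroup _ _
∗-commutativeSemigroup = record
  { Carrier = Series
  ; _≈_ = _≗_
  ; _∙_ = _∗_
  ; isCommutativeSemigroup = record
    { isSemigroup = record
      { isMagma = record
        { isEquivalence = record { refl = λ _ → refl ; sym = λ p n → sym (p n) ; trans = λ p q n → trans (p n) (q n) }
        ; ∙-cong = ∗-cong
        }
      ; assoc = ∗-assoc
      }
    ; comm = ∗-comm
    }
  }

open import Algebra.Properties.CommutativeSemigroup ∗-commutativeSemigroup using () renaming (interchange to ∗-interchange)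

zipWith-applyUpTo : ∀ {A B C : Set} (_∙_ : A → B → C) g h n →
  zipWith _∙_ (applyUpTo g n) (applyUpTo h n) ≡ applyUpTo (λ k → g k ∙ h k) n
zipWith-applyUpTo _∙_ g h zero    = refl
zipWith-applyUpTo _∙_ g h (suc n) = cong (g 0 ∙ h 0 ∷_) (zipWith-applyUpTo _∙_ (g ∘ suc) (h ∘ suc) n)

invList≡reversed-coefficients : ∀ a n → invList a n ≡ applyUpTo (λ k → inv a (n ∸ k)) (suc n)
invList≡reversed-coefficients a zero    = refl
invList≡reversed-coefficients a (suc n) = cong (inv a (suc n) ∷_) (invList≡reversed-coefficients a n)

inv-suc : ∀ a n → inv a (suc n) ≡ - (tail a ∗ inv a) n
inv-suc a n = trans (cong (λ l → - sumℤ l) paired-coefficients) (cong -_ (⊛≗∗ (tail a) (inv a) n))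
  where
  open ≡-Reasoning
  paired-coefficients : zipWith _⊗_ (map a (map suc (upTo (suc n)))) (invList a n)
                      ≡ map (λ k → tail a k ⊗ inv a (n ∸ k)) (upTo (suc n))
  paired-coefficients = begin
      zipWith _⊗_ (map a (map suc (upTo (suc n)))) (invList a n)
    ≡⟨ cong₂ (zipWith _⊗_) (trans (cong (map a) (map-applyUpTo suc (λ k → k) (suc n))) (map-applyUpTo a suc (suc n)))
                             (invList≡reversed-coefficients a n) ⟩
      zipWith _⊗_ (applyUpTo (a ∘ suc) (suc n)) (applyUpTo (λ k → inv a (n ∸ k)) (suc n))
    ≡⟨ zipWith-applyUpTo _⊗_ (a ∘ suc) (λ k → inv a (n ∸ k)) (suc n) ⟩
      applyUpTo (λ k → tail a k ⊗ inv a (n ∸ k)) (suc n)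
    ≡⟨ map-applyUpTo (λ k → tail a k ⊗ inv a (n ∸ k)) (λ k → k) (suc n) ⟨
      map (λ k → tail a k ⊗ inv a (n ∸ k)) (upTo (suc n))
    ∎

∗-inverseʳ : ∀ a → a 0 ≡ + 1 → a ∗ inv a ≗ one
∗-inverseʳ a a₀≡1 zero    rewrite a₀≡1 = refl
∗-inverseʳ a a₀≡1 (suc n) rewrite a₀≡1 | inv-suc a n = x-x≡0 ((tail a ∗ inv a) n)
  where
  x-x≡0 : ∀ x → + 1 ⊗ (- x) ⊕ x ≡ + 0
  x-x≡0 = solve-∀

-- Finite sums

χ : ∀ {p} {P : Set p} → Dec P → ℕ
χ (yes _) = 1
χ (no _)  = 0

χ-cong : ∀ {p q} {P : Set p} {Q : Set q} → (P → Q) → (Q → P) → (P? : Dec P) (Q? : Dec Q) → χ P? ≡ χ Q?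
χ-cong _   _   (yes _) (yes _) = refl
χ-cong P→Q _   (yes p) (no ¬q) = ⊥-elim (¬q (P→Q p))
χ-cong _   Q→P (no ¬p) (yes q) = ⊥-elim (¬p (Q→P q))
χ-cong _   _   (no _)  (no _)  = refl

χ-yes : ∀ {p} {P : Set p} → P → (P? : Dec P) → χ P? ≡ 1
χ-yes _ (yes _) = refl
χ-yes p (no ¬p) = ⊥-elim (¬p p)

χ-no : ∀ {p} {P : Set p} → ¬ P → (P? : Dec P) → χ P? ≡ 0
χ-no ¬p (yes p) = ⊥-elim (¬p p)
χ-no _  (no _)  = refl

∑< : ℕ → (ℕ → ℕ) → ℕ
∑< zero    f = 0
∑< (suc N) f = f N + ∑< N f

syntax ∑< N (λ i → e) = ∑[ i < N ] e

∑-cong : ∀ N {f g} → (∀ i → i < N → f i ≡ g i) → ∑< N f ≡ ∑< N g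
∑-cong zero    f≡g = refl
∑-cong (suc N) f≡g = cong₂ _+_ (f≡g N ℕP.≤-refl) (∑-cong N (λ i i<N → f≡g i (ℕP.m<n⇒m<1+n i<N)))

∑-zero : ∀ N {f} → (∀ i → i < N → f i ≡ 0) → ∑< N f ≡ 0
∑-zero zero    f≡0 = refl
∑-zero (suc N) f≡0 = cong₂ _+_ (f≡0 N ℕP.≤-refl) (∑-zero N (λ i i<N → f≡0 i (ℕP.m<n⇒m<1+n i<N)))

∑-distrib-+ : ∀ N f g → ∑[ i < N ] (f i + g i) ≡ ∑< N f + ∑< N g
∑-distrib-+ zero    f g = refl
∑-distrib-+ (suc N) f g = trans (cong (λ z → f N + g N + z) (∑-distrib-+ N f g)) (ℕ+.interchange (f N) (g N) (∑< N f) (∑< N g))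

∑-comm : ∀ N M (F : ℕ → ℕ → ℕ) → ∑[ i < N ] ∑[ j < M ] F i j ≡ ∑[ j < M ] ∑[ i < N ] F i j
∑-comm zero    M F = sym (∑-zero M (λ _ _ → refl))
∑-comm (suc N) M F = trans (cong (λ z → ∑< M (F N) + z) (∑-comm N M F))
  (sym (∑-distrib-+ M (F N) (λ j → ∑[ i < N ] F i j)))

∑-δ : ∀ N {q} (g : ℕ → ℕ) → q < N → ∑[ j < N ] (χ (j ℕ.≟ q) * g j) ≡ g q
∑-δ (suc N) {q} g q<N+1 with ℕP.m≤n⇒m<n∨m≡n (ℕP.≤-pred q<N+1)
... | inj₁ q<N  = trans (cong (λ z → z * g N + ∑[ j < N ] (χ (j ℕ.≟ q) * g j)) (χ-no (λ N≡q → ℕP.<-irrefl (sym N≡q) q<N) (N ℕ.≟ q)))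
                        (∑-δ N g q<N)
... | inj₂ refl = trans (cong₂ _+_ (cong (_* g q) (χ-yes refl (q ℕ.≟ q)))
                                   (∑-zero q (λ i i<q → cong (_* g i) (χ-no (λ i≡q → ℕP.<-irrefl i≡q i<q) (i ℕ.≟ q)))))
                        (trans (ℕP.+-identityʳ _) (ℕP.+-identityʳ (g q)))

∑-truncate : ∀ N k (f : ℕ → ℕ) → (∀ i → k ≤ i → f i ≡ 0) → k ≤ N → ∑< N f ≡ ∑< k f
∑-truncate zero    k f f≡0 z≤n = refl
∑-truncate (suc N) k f f≡0 k≤N+1 with ℕP.m≤n⇒m<n∨m≡n k≤N+1
... | inj₂ refl = refl
... | inj₁ k<N+1 = trans (cong (_+ ∑< N f) (f≡0 N (ℕP.≤-pred k<N+1))) (∑-truncate N k f f≡0 (ℕP.≤-pred k<N+1))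

-- Monomials, shifts and truncated products

monomial : ℕ → Series
monomial d n = + χ (n ℕ.≟ d)

monomial-0 : monomial 0 ≗ one
monomial-0 zero    = refl
monomial-0 (suc n) = refl

oneMinusQ^≗one-monomial : ∀ d → oneMinusQ^ d ≗ one +ˢ -ˢ monomial d
oneMinusQ^≗one-monomial d zero with 0 ℕ.≟ d
... | yes _ = refl
... | no _  = refl
oneMinusQ^≗one-monomial d (suc n) with suc n ℕ.≟ d
... | yes _ = refl
... | no _  = refl

shift : ℕ → Series → Series
shift zero    b n       = b n
shift (suc d) b zero    = + 0
shift (suc d) b (suc n) = shift d b n

shift-< : ∀ d b {n} → n < d → shift d b n ≡ + 0
shift-< (suc d) b {zero}  _         = refl
shift-< (suc d) b {suc n} (s≤s n<d) = shift-< d b n<d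

shift-+ : ∀ d b k → shift d b (d + k) ≡ b k
shift-+ zero    b k = refl
shift-+ (suc d) b k = shift-+ d b k

monomial-∗ : ∀ d b → monomial d ∗ b ≗ shift d b
monomial-∗ zero    b n       = trans (∗-cong monomial-0 (λ _ → refl) n) (∗-identityˡ b n)
monomial-∗ (suc d) b zero    = ℤP.*-zeroˡ (b 0)
monomial-∗ (suc d) b (suc n) = begin
    + 0 ⊗ b (suc n) ⊕ (tail (monomial (suc d)) ∗ b) n
  ≡⟨ cong₂ _⊕_ (ℤP.*-zeroˡ (b (suc n))) (∗-cong {b = b} tail-monomial (λ _ → refl) n) ⟩
    + 0 ⊕ (monomial d ∗ b) n
  ≡⟨ trans (ℤP.+-identityˡ _) (monomial-∗ d b n) ⟩
    shift d b n
  ∎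
  where
  open ≡-Reasoning
  tail-monomial : tail (monomial (suc d)) ≗ monomial d
  tail-monomial k = cong +_ (χ-cong ℕP.suc-injective (cong suc) _ _)

oneMinusQ^-∗ : ∀ d b → oneMinusQ^ d ∗ b ≗ b +ˢ -ˢ shift d b
oneMinusQ^-∗ d b n = begin
    (oneMinusQ^ d ∗ b) n
  ≡⟨ ∗-cong (oneMinusQ^≗one-monomial d) (λ _ → refl) n ⟩
    ((one +ˢ -ˢ monomial d) ∗ b) n
  ≡⟨ ∗-distribʳ-+ b one (-ˢ monomial d) n ⟩
    (one ∗ b) n ⊕ (-ˢ monomial d ∗ b) n
  ≡⟨ cong₂ _⊕_ (∗-identityˡ b n) (trans (∗-negˡ (monomial d) b n) (cong -_ (monomial-∗ d b n))) ⟩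
    b n - shift d b n
  ∎
  where open ≡-Reasoning

shift-cong : ∀ d {b b′} → b ≗ b′ → shift d b ≗ shift d b′
shift-cong zero    b≗b′ n       = b≗b′ n
shift-cong (suc d) b≗b′ zero    = refl
shift-cong (suc d) b≗b′ (suc n) = shift-cong d b≗b′ n

shift-pointwise : ∀ (op : ℤ → ℤ → ℤ) → op (+ 0) (+ 0) ≡ + 0 →
                  ∀ d a b → shift d (λ k → op (a k) (b k)) ≗ λ k → op (shift d a k) (shift d b k)
shift-pointwise op op00≡0 zero    a b n       = refl
shift-pointwise op op00≡0 (suc d) a b zero    = sym op00≡0
shift-pointwise op op00≡0 (suc d) a b (suc n) = shift-pointwise op op00≡0 d a b n

shift-shift : ∀ d d′ b → shift (d + d′) b ≗ shift d (shift d′ b)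
shift-shift zero    d′ b n       = refl
shift-shift (suc d) d′ b zero    = refl
shift-shift (suc d) d′ b (suc n) = shift-shift d d′ b n

shift-one : ∀ d → shift d one ≗ monomial d
shift-one zero    n       = sym (monomial-0 n)
shift-one (suc d) zero    = refl
shift-one (suc d) (suc n) = trans (shift-one d n) (cong +_ (χ-cong (cong suc) ℕP.suc-injective _ _))

finProd-suc-< : ∀ r N {k} → k < r * suc N → finProd r (suc N) k ≡ finProd r N k
finProd-suc-< r N {k} k<r[N+1] = begin
    (oneMinusQ^ (r * suc N) ⊛ finProd r N) k
  ≡⟨ ⊛≗∗ (oneMinusQ^ (r * suc N)) (finProd r N) k ⟩
    (oneMinusQ^ (r * suc N) ∗ finProd r N) k
  ≡⟨ oneMinusQ^-∗ (r * suc N) (finProd r N) k ⟩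
    finProd r N k - shift (r * suc N) (finProd r N) k
  ≡⟨ cong (λ z → finProd r N k - z) (shift-< (r * suc N) (finProd r N) k<r[N+1]) ⟩
    finProd r N k - + 0
  ≡⟨ ℤP.+-identityʳ _ ⟩
    finProd r N k
  ∎
  where open ≡-Reasoning

finProd≡f : ∀ r .{{_ : NonZero r}} N {k} → k ≤ N → finProd r N k ≡ f r k
finProd≡f r zero    z≤n = refl
finProd≡f r (suc N) {k} k≤N+1 with ℕP.m≤n⇒m<n∨m≡n k≤N+1
... | inj₂ refl = refl
... | inj₁ k<N+1 = trans (finProd-suc-< r N (ℕP.<-≤-trans k<N+1 (ℕP.m≤n*m (suc N) r)))
                         (finProd≡f r N (ℕP.≤-pred k<N+1))

-- The square of 1 - q^e modulo 4

-- Vanishes at n = 0, so that multiples e is Σ_{j≥1} q^{ej}.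
multipleIndicator : ℕ → ℕ → ℕ
multipleIndicator e zero    = 0
multipleIndicator e (suc n) = χ (e ℕ∣.∣? suc n)

multiples : ℕ → Series
multiples e n = + multipleIndicator e n

multiples-unfold : ∀ m → multiples (suc m) ≗ monomial (suc m) +ˢ shift (suc m) (multiples (suc m))
multiples-unfold m n with n ℕ.<? suc m
... | yes n<e = begin
    multiples e n                             ≡⟨ multiples-< n n<e ⟩
    + 0 ⊕ + 0                                 ≡⟨ cong₂ _⊕_ (cong +_ (χ-no (λ n≡e → ℕP.<-irrefl n≡e n<e) _)) (shift-< e (multiples e) n<e) ⟨
    monomial e n ⊕ shift e (multiples e) n    ∎
  where
  open ≡-Reasoning
  e = suc m
  multiples-< : ∀ n → n < e → multiples e n ≡ + 0 ⊕ + 0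
  multiples-< zero    _     = refl
  multiples-< (suc n) n+1<e = cong +_ (χ-no (λ e∣n+1 → ℕP.<⇒≱ n+1<e (ℕ∣.∣⇒≤ e∣n+1)) _)
... | no n≮e with ℕP.m≤n⇒∃[o]m+o≡n (ℕP.≮⇒≥ n≮e)
... | k , refl = trans (multiples-e+ k) (cong (monomial e (e + k) ⊕_) (sym (shift-+ e (multiples e) k)))
  where
  e = suc m
  multiples-e+ : ∀ k → multiples e (e + k) ≡ monomial e (e + k) ⊕ multiples e k
  multiples-e+ zero    = trans (cong +_ (χ-yes (ℕ∣.∣m∣n⇒∣m+n ℕ∣.∣-refl (ℕ∣.divides 0 refl)) _))
                                (sym (cong (λ z → + z ⊕ + 0) (χ-yes (ℕP.+-identityʳ e) _)))
  multiples-e+ (suc k) = trans (cong +_ (χ-cong (λ e∣e+k+1 → ℕ∣.∣m+n∣m⇒∣n e∣e+k+1 ℕ∣.∣-refl) (ℕ∣.∣m∣n⇒∣m+n ℕ∣.∣-refl) _ _))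
    (sym (trans (cong (λ z → + z ⊕ multiples e (suc k)) (χ-no (ℕP.m+1+n≢m e) _)) (ℤP.+-identityˡ _)))

-- Exactly, (1 - q^e)² = (1 - q^{2e}) (1 + 2 Σ_{j≥1} q^{ej}) - 4 q^e.
oneMinusQ^-square : ∀ m → let e = suc m in
  oneMinusQ^ e ∗ oneMinusQ^ e ≡ˢ oneMinusQ^ (2 * e) ∗ (one +ˢ + 2 ·ˢ multiples e) mod + 4
oneMinusQ^-square m n = ≡+q*m⇒≡mod (- x₁) (begin
    (O ∗ O) n
  ≡⟨ oneMinusQ^-∗ e O n ⟩
    O n - shift e O n
  ≡⟨ cong₂ _-_ (oneMinusQ^≗one-monomial e n) shift-O ⟩
    (one n - x₁) - (x₁ - x₂)
  ≡⟨ regroup (one n) x₁ x₂ (G n) ⟩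
    (H n - (x₂ ⊕ + 2 ⊗ ((G n - x₁) - x₂))) ⊕ - x₁ ⊗ + 4
  ≡⟨ cong (λ z → H n - z ⊕ - x₁ ⊗ + 4) shift-2e-H ⟨
    (H n - shift (2 * e) H n) ⊕ - x₁ ⊗ + 4
  ≡⟨ cong (_⊕ - x₁ ⊗ + 4) (oneMinusQ^-∗ (2 * e) H n) ⟨
    (oneMinusQ^ (2 * e) ∗ H) n ⊕ - x₁ ⊗ + 4
  ∎)
  where
  open ≡-Reasoning
  e = suc m
  O = oneMinusQ^ e
  G = multiples e
  H = one +ˢ + 2 ·ˢ G
  x₁ = monomial e n
  x₂ = shift e (monomial e) n

  regroup : ∀ o x₁ x₂ g → (o - x₁) - (x₁ - x₂) ≡ ((o ⊕ + 2 ⊗ g) - (x₂ ⊕ + 2 ⊗ ((g - x₁) - x₂))) ⊕ - x₁ ⊗ + 4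
  regroup = solve-∀

  shift-O : shift e O n ≡ x₁ - x₂
  shift-O = begin
      shift e O n                                      ≡⟨ shift-cong e (oneMinusQ^≗one-monomial e) n ⟩
      shift e (λ k → one k - monomial e k) n           ≡⟨ shift-pointwise _-_ refl e one (monomial e) n ⟩
      shift e one n - x₂                               ≡⟨ cong (_- x₂) (shift-one e n) ⟩
      x₁ - x₂                                          ∎

  shift-G : ∀ k → shift e G k ≡ G k - monomial e k
  shift-G k = trans (y≡[x+y]-x (monomial e k) (shift e G k)) (cong (_- monomial e k) (sym (multiples-unfold m k)))
    where
    y≡[x+y]-x : ∀ x y → y ≡ (x ⊕ y) - x
    y≡[x+y]-x = solve-∀

  shift-H : ∀ k → shift e H k ≡ monomial e k ⊕ + 2 ⊗ (G k - monomial e k)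
  shift-H k = trans (shift-pointwise (λ u v → u ⊕ + 2 ⊗ v) refl e one G k)
                    (cong₂ (λ u v → u ⊕ + 2 ⊗ v) (shift-one e k) (shift-G k))

  shift-2e-H : shift (2 * e) H n ≡ x₂ ⊕ + 2 ⊗ ((G n - x₁) - x₂)
  shift-2e-H = begin
      shift (2 * e) H n
    ≡⟨ cong (λ d → shift (e + d) H n) (ℕP.+-identityʳ e) ⟩
      shift (e + e) H n
    ≡⟨ shift-shift e e H n ⟩
      shift e (shift e H) n
    ≡⟨ shift-cong e shift-H n ⟩
      shift e (λ k → monomial e k ⊕ + 2 ⊗ (G k - monomial e k)) n
    ≡⟨ shift-pointwise (λ u v → u ⊕ + 2 ⊗ (v - u)) refl e (monomial e) G n ⟩
      x₂ ⊕ + 2 ⊗ (shift e G n - x₂)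
    ≡⟨ cong (λ z → x₂ ⊕ + 2 ⊗ (z - x₂)) (shift-G n) ⟩
      x₂ ⊕ + 2 ⊗ ((G n - x₁) - x₂)
    ∎

[1+2x][1+2y]≡1+2[x+y] : ∀ x y → (one +ˢ + 2 ·ˢ x) ∗ (one +ˢ + 2 ·ˢ y) ≡ˢ one +ˢ + 2 ·ˢ (x +ˢ y) mod + 4
[1+2x][1+2y]≡1+2[x+y] x y n = ≡+q*m⇒≡mod ((x ∗ y) n) (begin
    ((one +ˢ + 2 ·ˢ x) ∗ H) n
  ≡⟨ ∗-distribʳ-+ H one (+ 2 ·ˢ x) n ⟩
    (one ∗ H) n ⊕ ((+ 2 ·ˢ x) ∗ H) n
  ≡⟨ cong₂ _⊕_ (∗-identityˡ H n) (∗-scaleˡ (+ 2) x H n) ⟩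
    H n ⊕ + 2 ⊗ (x ∗ H) n
  ≡⟨ cong (λ z → H n ⊕ + 2 ⊗ z) (trans (∗-distribˡ-+ x one (+ 2 ·ˢ y) n) (cong₂ _⊕_ (∗-identityʳ x n) (∗-scaleʳ (+ 2) y x n))) ⟩
    H n ⊕ + 2 ⊗ (x n ⊕ + 2 ⊗ (x ∗ y) n)
  ≡⟨ regroup (one n) (x n) (y n) ((x ∗ y) n) ⟩
    (one n ⊕ + 2 ⊗ (x n ⊕ y n)) ⊕ (x ∗ y) n ⊗ + 4
  ∎)
  where
  open ≡-Reasoning
  H = one +ˢ + 2 ·ˢ y
  regroup : ∀ o x y z → (o ⊕ + 2 ⊗ y) ⊕ + 2 ⊗ (x ⊕ + 2 ⊗ z) ≡ (o ⊕ + 2 ⊗ (x ⊕ y)) ⊕ z ⊗ + 4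
  regroup = solve-∀

divisorCounts : ℕ → Series
divisorCounts N n = + ∑[ i < N ] multipleIndicator (suc i) n

finProd-square : ∀ N → finProd 1 N ∗ finProd 1 N ≡ˢ finProd 2 N ∗ (one +ˢ + 2 ·ˢ divisorCounts N) mod + 4
finProd-square zero    = ≗⇒≡ˢmod (λ n → trans (∗-identityˡ one n) (sym (trans (∗-identityˡ _ n) (ℤP.+-identityʳ (one n)))))
finProd-square (suc N) = begin
    (O₁ ⊛ P₁) ∗ (O₁ ⊛ P₁)                ≈⟨ ≗⇒≡ˢmod (∗-cong (⊛≗∗ O₁ P₁) (⊛≗∗ O₁ P₁)) ⟩
    (O₁ ∗ P₁) ∗ (O₁ ∗ P₁)                ≈⟨ ≗⇒≡ˢmod (∗-interchange O₁ P₁ O₁ P₁) ⟩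
    (O₁ ∗ O₁) ∗ (P₁ ∗ P₁)                ≈⟨ ∗-cong-mod O₁-square (finProd-square N) ⟩
    (O₂ ∗ H) ∗ (P₂ ∗ D)                  ≈⟨ ≗⇒≡ˢmod (∗-interchange O₂ H P₂ D) ⟩
    (O₂ ∗ P₂) ∗ (H ∗ D)                  ≈⟨ ∗-cong-mod {a = O₂ ∗ P₂} (λ _ → ≡mod-refl) ([1+2x][1+2y]≡1+2[x+y] (multiples (suc N)) (divisorCounts N)) ⟩
    (O₂ ∗ P₂) ∗ (one +ˢ + 2 ·ˢ divisorCounts (suc N))
                                         ≈⟨ ≗⇒≡ˢmod (∗-cong (λ k → sym (⊛≗∗ O₂ P₂ k)) (λ _ → refl)) ⟩
    (O₂ ⊛ P₂) ∗ (one +ˢ + 2 ·ˢ divisorCounts (suc N))  ∎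
  where
  open SetoidReasoning (≡ˢmod-setoid {+ 4})
  O₁ = oneMinusQ^ (1 * suc N)
  O₂ = oneMinusQ^ (2 * suc N)
  P₁ = finProd 1 N
  P₂ = finProd 2 N
  H = one +ˢ + 2 ·ˢ multiples (suc N)
  D = one +ˢ + 2 ·ˢ divisorCounts N
  O₁-square : O₁ ∗ O₁ ≡ˢ O₂ ∗ H mod + 4
  O₁-square = subst (λ O → O ∗ O ≡ˢ O₂ ∗ H mod + 4) (cong oneMinusQ^ (sym (ℕP.*-identityˡ (suc N)))) (oneMinusQ^-square N)

-- Divisor counts modulo 2

∑²-symmetric : ∀ N (E : ℕ → ℕ → ℕ) → (∀ i j → E i j ≡ E j i) →
  ∑[ i < N ] ∑[ j < N ] E i j ≡ 2 * ∑[ i < N ] ∑[ j < N ] (χ (i ℕ.<? j) * E i j) + ∑[ i < N ] E i i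
∑²-symmetric N E E-sym = begin
    ΣΣ E                        ≡⟨ ∑-cong N (λ i _ → trans (∑-cong N (λ j _ → trichotomy i j)) (∑-distrib-+ N _ (R i))) ⟩
    ∑[ i < N ] (∑< N (λ j → L i j + D i j) + ∑< N (R i))
                                ≡⟨ ∑-distrib-+ N _ _ ⟩
    ∑[ i < N ] ∑< N (λ j → L i j + D i j) + ΣΣ R
                                ≡⟨ cong₂ _+_ (trans (∑-cong N (λ i _ → ∑-distrib-+ N (L i) (D i))) (∑-distrib-+ N _ _)) upper≡lower ⟩
    ΣΣ L + ΣΣ D + ΣΣ L          ≡⟨ cong (λ z → ΣΣ L + z + ΣΣ L) (∑-cong N (λ i i<N → ∑-δ N (E i) i<N)) ⟩
    ΣΣ L + ∑< N (λ i → E i i) + ΣΣ L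
                                ≡⟨ rearrange (ΣΣ L) (∑< N (λ i → E i i)) ⟩
    2 * ΣΣ L + ∑< N (λ i → E i i) ∎
  where
  open ≡-Reasoning
  ΣΣ : (ℕ → ℕ → ℕ) → ℕ
  ΣΣ F = ∑[ i < N ] ∑[ j < N ] F i j
  L D R : ℕ → ℕ → ℕ
  L i j = χ (i ℕ.<? j) * E i j
  D i j = χ (j ℕ.≟ i) * E i j
  R i j = χ (j ℕ.<? i) * E i j

  trichotomy : ∀ i j → E i j ≡ L i j + D i j + R i j
  trichotomy i j with ℕP.<-cmp i j
  ... | tri< i<j _ _ rewrite χ-yes i<j (i ℕ.<? j) | χ-no (λ j≡i → ℕP.<-irrefl (sym j≡i) i<j) (j ℕ.≟ i)
                           | χ-no (ℕP.<-asym i<j) (j ℕ.<? i) = sym (trans (ℕP.+-identityʳ _) (trans (ℕP.+-identityʳ _) (ℕP.+-identityʳ _)))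
  ... | tri≈ _ refl _ rewrite χ-no (ℕP.<-irrefl refl) (i ℕ.<? i) | χ-yes refl (i ℕ.≟ i) = sym (trans (ℕP.+-identityʳ _) (ℕP.+-identityʳ _))
  ... | tri> _ _ j<i  rewrite χ-no (ℕP.<-asym j<i) (i ℕ.<? j) | χ-no (λ j≡i → ℕP.<-irrefl j≡i j<i) (j ℕ.≟ i)
                           | χ-yes j<i (j ℕ.<? i) = sym (ℕP.+-identityʳ _)

  upper≡lower : ΣΣ R ≡ ΣΣ L
  upper≡lower = trans (∑-cong N (λ i _ → ∑-cong N (λ j _ → cong (χ (j ℕ.<? i) *_) (E-sym i j)))) (∑-comm N N (λ i j → L j i))

  rearrange : ∀ u d → u + d + u ≡ 2 * u + d
  rearrange = ℕ-solve-∀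

squareCount : ℕ → ℕ
squareCount n = ∑[ i < n ] χ (suc i * suc i ℕ.≟ n)

-- Divisors d of n pair up with n / d, except d = √n.
divisorCount-parity : ∀ n′ → let n = suc n′ in
  ∑[ i < n ] multipleIndicator (suc i) n ≡ 2 * ∑[ i < n ] ∑[ j < n ] (χ (i ℕ.<? j) * χ (suc i * suc j ℕ.≟ n)) + squareCount n
divisorCount-parity n′ = trans (∑-cong n (λ i _ → multipleIndicator≡∑ i))
  (∑²-symmetric n E (λ i j → χ-cong (trans (ℕP.*-comm (suc j) (suc i))) (trans (ℕP.*-comm (suc i) (suc j))) _ _))
  where
  n = suc n′
  E : ℕ → ℕ → ℕ
  E i j = χ (suc i * suc j ℕ.≟ n)

  multipleIndicator≡∑ : ∀ i → multipleIndicator (suc i) n ≡ ∑[ j < n ] E i j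
  multipleIndicator≡∑ i with suc i ℕ∣.∣? n
  ... | no i+1∤n = sym (∑-zero n (λ j _ → χ-no (λ eq → i+1∤n (ℕ∣.divides (suc j) (trans (sym eq) (ℕP.*-comm (suc i) (suc j))))) _))
  ... | yes (ℕ∣.divides zero ())
  ... | yes (ℕ∣.divides (suc q) n≡[q+1][i+1]) =
    sym (trans (∑-cong n (λ j _ → trans (χ-cong ≡n⇒≡q ≡q⇒≡n (suc i * suc j ℕ.≟ n) (j ℕ.≟ q)) (sym (ℕP.*-identityʳ _))))
               (∑-δ n (λ _ → 1) q<n))
    where
    n≡[i+1][q+1] : n ≡ suc i * suc q
    n≡[i+1][q+1] = trans n≡[q+1][i+1] (ℕP.*-comm (suc q) (suc i))
    ≡n⇒≡q : ∀ {j} → suc i * suc j ≡ n → j ≡ q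
    ≡n⇒≡q {j} eq = ℕP.suc-injective (ℕP.*-cancelˡ-≡ (suc j) (suc q) (suc i) (trans eq n≡[i+1][q+1]))
    ≡q⇒≡n : ∀ {j} → j ≡ q → suc i * suc j ≡ n
    ≡q⇒≡n refl = sym n≡[i+1][q+1]
    q<n : q < n
    q<n = ℕP.<-≤-trans (ℕP.n<1+n q) (subst (suc q ≤_) (sym n≡[q+1][i+1]) (ℕP.m≤m*n (suc q) (suc i)))

-- Ramanujan's φ(q) = Σ_{m ∈ ℤ} q^{m²} = 1 + 2 Σ_{m ≥ 1} q^{m²}.
φ : Series
φ = one +ˢ + 2 ·ˢ (λ n → + squareCount n)

1+2divisorCounts≡φ : ∀ N {k} → k ≤ N → (one +ˢ + 2 ·ˢ divisorCounts N) k ≡ φ k mod + 4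
1+2divisorCounts≡φ N {zero}  _       = ≡⇒≡mod (cong (λ z → + 1 ⊕ + 2 ⊗ + z) (∑-zero N (λ _ _ → refl)))
1+2divisorCounts≡φ N {suc k} k+1≤N = ≡+q*m⇒≡mod (+ U) (begin
    + 0 ⊕ + 2 ⊗ + ∑[ i < N ] multipleIndicator (suc i) (suc k)
  ≡⟨ cong (λ z → + 0 ⊕ + 2 ⊗ + z) (trans (∑-truncate N (suc k) _ vanishes k+1≤N) (divisorCount-parity k)) ⟩
    + 0 ⊕ + 2 ⊗ + (2 * U + squareCount (suc k))
  ≡⟨ cong (λ z → + 0 ⊕ + 2 ⊗ z) (trans (ℤP.pos-+ (2 * U) _) (cong (_⊕ + squareCount (suc k)) (ℤP.pos-* 2 U))) ⟩
    + 0 ⊕ + 2 ⊗ (+ 2 ⊗ + U ⊕ + squareCount (suc k))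
  ≡⟨ regroup (+ U) (+ squareCount (suc k)) ⟩
    + 0 ⊕ + 2 ⊗ + squareCount (suc k) ⊕ + U ⊗ + 4
  ∎)
  where
  open ≡-Reasoning
  U = ∑[ i < suc k ] ∑[ j < suc k ] (χ (i ℕ.<? j) * χ (suc i * suc j ℕ.≟ suc k))
  vanishes : ∀ i → suc k ≤ i → multipleIndicator (suc i) (suc k) ≡ 0
  vanishes i k+1≤i = χ-no (λ i+1∣k+1 → ℕP.<⇒≱ (s≤s k+1≤i) (ℕ∣.∣⇒≤ i+1∣k+1)) _
  regroup : ∀ u s → + 0 ⊕ + 2 ⊗ (+ 2 ⊗ u ⊕ s) ≡ + 0 ⊕ + 2 ⊗ s ⊕ u ⊗ + 4
  regroup = solve-∀

-- The main congruence

f₁²≡f₂φ : f 1 ⊛ f 1 ≡ˢ f 2 ∗ φ mod + 4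
f₁²≡f₂φ n = begin
    (f 1 ⊛ f 1) n                         ≡⟨ ⊛≗∗ (f 1) (f 1) n ⟩
    (f 1 ∗ f 1) n                         ≈⟨ ∗-cong-≤-mod n f₁≡finProd f₁≡finProd ⟩
    (finProd 1 n ∗ finProd 1 n) n         ≈⟨ finProd-square n n ⟩
    (finProd 2 n ∗ (one +ˢ + 2 ·ˢ divisorCounts n)) n
                                          ≈⟨ ∗-cong-≤-mod n (λ k k≤n → ≡⇒≡mod (finProd≡f 2 n k≤n)) (λ k → 1+2divisorCounts≡φ n) ⟩
    (f 2 ∗ φ) n                           ∎
  where
  open SetoidReasoning (≡mod-setoid {+ 4})
  f₁≡finProd : ∀ k → k ≤ n → f 1 k ≡ finProd 1 n k mod + 4
  f₁≡finProd k k≤n = ≡⇒≡mod (sym (finProd≡f 1 n k≤n))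

square≡1⇒quotient≡ : ∀ {m a b c t} → a ∗ b ≗ one → a ≡ˢ c ∗ t mod m → t ∗ t ≡ˢ one mod m → c ∗ b ≡ˢ t mod m
square≡1⇒quotient≡ {m} {a} {b} {c} {t} ab≗1 a≡ct tt≡1 = begin
    c ∗ b                 ≈⟨ ≗⇒≡ˢmod (λ n → sym (∗-identityʳ (c ∗ b) n)) ⟩
    (c ∗ b) ∗ one         ≈⟨ ∗-cong-mod {a = c ∗ b} (λ _ → ≡mod-refl) (λ n → ≡mod-sym (tt≡1 n)) ⟩
    (c ∗ b) ∗ (t ∗ t)     ≈⟨ ≗⇒≡ˢmod (∗-interchange c b t t) ⟩
    (c ∗ t) ∗ (b ∗ t)     ≈⟨ ∗-cong-mod (λ n → ≡mod-sym (a≡ct n)) (λ _ → ≡mod-refl) ⟩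
    a ∗ (b ∗ t)           ≈⟨ ≗⇒≡ˢmod (λ n → sym (∗-assoc a b t n)) ⟩
    (a ∗ b) ∗ t           ≈⟨ ≗⇒≡ˢmod (λ n → trans (∗-cong ab≗1 (λ _ → refl) n) (∗-identityˡ t n)) ⟩
    t                     ∎
  where open SetoidReasoning (≡ˢmod-setoid {m})

φ²≡1 : φ ∗ φ ≡ˢ one mod + 4
φ²≡1 n = ≡mod-trans ([1+2x][1+2y]≡1+2[x+y] S S n) (≡+q*m⇒≡mod (S n) (regroup (one n) (S n)))
  where
  S : Series
  S k = + squareCount k
  regroup : ∀ o s → o ⊕ + 2 ⊗ (s ⊕ s) ≡ o ⊕ s ⊗ + 4
  regroup = solve-∀

^ˢ-cong-mod : ∀ {m a b} t → a ≡ˢ b mod m → a ^ˢ t ≡ˢ b ^ˢ t mod m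
^ˢ-cong-mod zero    a≡b n = ≡mod-refl
^ˢ-cong-mod {a = a} {b} (suc t) a≡b n = begin
    (a ⊛ a ^ˢ t) n  ≡⟨ ⊛≗∗ a (a ^ˢ t) n ⟩
    (a ∗ a ^ˢ t) n  ≈⟨ ∗-cong-mod a≡b (^ˢ-cong-mod t a≡b) n ⟩
    (b ∗ b ^ˢ t) n  ≡⟨ ⊛≗∗ b (b ^ˢ t) n ⟨
    (b ⊛ b ^ˢ t) n  ∎
  where open SetoidReasoning ≡mod-setoid

square≡1⇒odd-power≡ : ∀ {m a} k → a ∗ a ≡ˢ one mod m → a ^ˢ (2 * k + 1) ≡ˢ a mod m
square≡1⇒odd-power≡ {m} {a} zero    aa≡1 = ≗⇒≡ˢmod (λ n → trans (⊛≗∗ a one n) (∗-identityʳ a n))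
square≡1⇒odd-power≡ {m} {a} (suc k) aa≡1 = subst (λ t → a ^ˢ t ≡ˢ a mod m) (sym (odd-suc k)) $ begin
    a ⊛ (a ⊛ a ^ˢ (2 * k + 1))   ≈⟨ ≗⇒≡ˢmod (λ n → trans (⊛≗∗ a _ n) (∗-cong {a = a} (λ _ → refl) (⊛≗∗ a _) n)) ⟩
    a ∗ (a ∗ a ^ˢ (2 * k + 1))   ≈⟨ ∗-cong-mod {a = a} (λ _ → ≡mod-refl) (∗-cong-mod {a = a} (λ _ → ≡mod-refl) (square≡1⇒odd-power≡ k aa≡1)) ⟩
    a ∗ (a ∗ a)                  ≈⟨ ∗-cong-mod {a = a} (λ _ → ≡mod-refl) aa≡1 ⟩
    a ∗ one                      ≈⟨ ≗⇒≡ˢmod (∗-identityʳ a) ⟩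
    a                            ∎
  where
  open SetoidReasoning (≡ˢmod-setoid {m})
  odd-suc : ∀ k → 2 * suc k + 1 ≡ suc (suc (2 * k + 1))
  odd-suc = ℕ-solve-∀

pbar≡φ : ∀ k → pbar (2 * k + 1) ≡ˢ φ mod + 4
pbar≡φ k n = ≡mod-trans (^ˢ-cong-mod (2 * k + 1) quotient≡φ n) (square≡1⇒odd-power≡ k φ²≡1 n)
  where
  quotient≡φ : f 2 ⊛ inv (f 1 ⊛ f 1) ≡ˢ φ mod + 4
  quotient≡φ n = ≡mod-trans (≡⇒≡mod (⊛≗∗ (f 2) _ n))
    (square≡1⇒quotient≡ (∗-inverseʳ (f 1 ⊛ f 1) refl) f₁²≡f₂φ φ²≡1 n)

square-injective : ∀ a b → a * a ≡ b * b → a ≡ b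
square-injective a b aa≡bb with ℕP.<-cmp a b
... | tri< a<b _ _ = ⊥-elim (ℕP.<-irrefl aa≡bb (ℕP.*-mono-< a<b a<b))
... | tri≈ _ a≡b _ = a≡b
... | tri> _ _ b<a = ⊥-elim (ℕP.<-irrefl (sym aa≡bb) (ℕP.*-mono-< b<a b<a))

squareCount-square : ∀ m → squareCount (suc m * suc m) ≡ 1
squareCount-square m = trans (∑-cong n (λ i _ → trans (χ-cong ≡n⇒≡m ≡m⇒≡n (suc i * suc i ℕ.≟ n) (i ℕ.≟ m)) (sym (ℕP.*-identityʳ _))))
                             (∑-δ n (λ _ → 1) (ℕP.m≤m*n (suc m) (suc m)))
  where
  n = suc m * suc m
  ≡n⇒≡m : ∀ {i} → suc i * suc i ≡ n → i ≡ m
  ≡n⇒≡m {i} eq = ℕP.suc-injective (square-injective (suc i) (suc m) eq)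
  ≡m⇒≡n : ∀ {i} → i ≡ m → suc i * suc i ≡ n
  ≡m⇒≡n refl = refl

squareCount-nonsquare : ∀ n → ¬ (∃[ m ] n ≡ m * m) → squareCount n ≡ 0
squareCount-nonsquare n nonsquare = ∑-zero n (λ i _ → χ-no (λ eq → nonsquare (suc i , sym eq)) _)

theorem3p2 : ∀ (k n : ℕ) → let t = 2 * k + 1 in
    (n ≡ 0 → pbar t n %ℕ 4 ≡ 1)
    × ((n ≥ 1 × ∃[ m ] n ≡ m * m) → pbar t n %ℕ 4 ≡ 2)
    × ((n ≥ 1 × ¬ (∃[ m ] n ≡ m * m)) → pbar t n %ℕ 4 ≡ 0)
theorem3p2 k n = zero-case , square-case , nonsquare-case
  where
  residue : ∀ {n r} → r < 4 → φ n ≡ + r → pbar (2 * k + 1) n %ℕ 4 ≡ r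
  residue {n} r<4 φn≡r = ≡mod⇒%ℕ≡ 4 (≡mod-trans (pbar≡φ k n) (≡⇒≡mod φn≡r)) r<4

  zero-case : n ≡ 0 → pbar (2 * k + 1) n %ℕ 4 ≡ 1
  zero-case refl = residue (s≤s (s≤s z≤n)) refl

  square-case : n ≥ 1 × ∃[ m ] n ≡ m * m → pbar (2 * k + 1) n %ℕ 4 ≡ 2
  square-case (_ , suc m , refl) = residue (s≤s (s≤s (s≤s z≤n))) (cong (λ s → + 0 ⊕ + 2 ⊗ + s) (squareCount-square m))

  nonsquare-case : n ≥ 1 × ¬ (∃[ m ] n ≡ m * m) → pbar (2 * k + 1) n %ℕ 4 ≡ 0
  nonsquare-case (s≤s _ , nonsquare) = residue (s≤s z≤n) (cong (λ s → + 0 ⊕ + 2 ⊗ + s) (squareCount-nonsquare n nonsquare))
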